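{- For $s\in\mu_r$, $v\in\mathcal{A}_1$ and $w\in\mathcal{A}_r$, \[ vz\diamond_s w=v\diamond_s wz=(v\diamond_s w)z. \]
   Context: Let $r\ge1$, $\mu_r$ the $r$-th roots of unity, $\mathcal{A}_r=\mathbb{Q}\langle x,y_s\mid s\in\mu_r\rangle$, $y=y_1$, $z=x+y_1$, $z_t=x+y_t$, $\delta(1)=0$, $\delta(s)=1$ for $s\ne1$, $z_{k,s}=x^{k-1}y_s$, $\mathcal{A}_1=\mathbb{Q}\langle x,y\rangle\subset\mathcal{A}_r$. $\varphi$: automorphism of $\mathcal{A}_r$ with $\varphi(x)=z$, $\varphi(y_s)=\delta(s)y_s-y_1$. $\mathcal{I}(z_{k_1,s_1}\cdots z_{k_l,s_l}x^a)=z_{k_1,s_1}z_{k_2,s_1s_2}\cdots z_{k_l,s_1\cdots s_l}x^a$, $M_s(z_{k_1,s_1}\cdots z_{k_l,s_l}x^a)=z_{k_1,ss_1}z_{k_2,s_2}\cdots z_{k_l,s_l}x^a$ (linear, $a\ge0$), $\psi_s=\varphi\mathcal{I}M_s$. Diamond product $\diamond_s:\mathcal{A}_1\times\mathcal{A}_r\to\mathcal{A}_r$ ($s\in\mu_r$): $\mathbb{Q}$-bilinear, defined recursively for words $v\in\mathcal{A}_1,w\in\mathcal{A}_r$, $1\ne t\in\mu_r$ by $1\diamond_s w=w$, $v\diamond_s1=\psi_s\varphi(v)$, $vx\diamond_s wx=(v\diamond_s wx)x-(vy\diamond_s w)x$, $vy\diamond_s wx=(v\diamond_s wx)y+(vy\diamond_s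 w)x$, $vx\diamond_s wy=(v\diamond_s wy)x+(vx\diamond_s w)y$, $vy\diamond_s wy=(v\diamond_s wy)y-(vx\diamond_s w)y$, $vx\diamond_s wy_t=(v\diamond_s wy_t)x+(v\diamond_s wz_t)y_t-(vy\diamond_s w)y_t$, $vy\diamond_s wy_t=(v\diamond_s wy_t)y-(v\diamond_s wz_t)y_t+(vy\diamond_s w)y_t$. -}

module Defs where

open import Data.Nat using (ℕ; zero; suc) renaming (_+_ to _+ℕ_)
open import Data.Nat.DivMod using (_mod_)
open import Data.Fin using (Fin; zero; suc; toℕ)
import Data.Fin.Properties as FinP
open import Data.List using (List; []; _∷_; _++_; [_]; map; concatMap; reverse; length; foldr)
import Data.List.Properties as ListP
open import Data.Product using (_×_; _,_)
open import Data.Rational using (ℚ; 0ℚ; 1ℚ) renaming (_+_ to _+ℚ_; _*_ to _*ℚ_; -_ to -ℚ_)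
open import Relation.Binary.PropositionalEquality using (_≡_; refl; cong)
open import Relation.Nullary using (Dec; yes; no)
open import Relation.Binary.Definitions using (DecidableEquality)

-- Roots of unity: μ_r with r = suc m is identified with Fin (suc m) via
-- ζ^k ↦ k, where ζ = exp(2πi/r).  The root 1 is `zero`, and the product
-- of roots is addition modulo r.

μ : ℕ → Set
μ m = Fin (suc m)

_·μ_ : {m : ℕ} → μ m → μ m → μ m
_·μ_ {m} a b = (toℕ a +ℕ toℕ b) mod (suc m)

one-μ : {m : ℕ} → μ m
one-μ = zero

δ : {m : ℕ} → μ m → ℚ
δ zero = 0ℚ
δ (suc _) = 1ℚ

data Letter (m : ℕ) : Set where
  lx : Letter m
  ly : μ m → Letter m

Word : ℕ → Set
Word m = List (Letter m)

letter-≟ : {m : ℕ} → DecidableEquality (Letter m)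
letter-≟ lx lx = yes refl
letter-≟ lx (ly _) = no (λ ())
letter-≟ (ly _) lx = no (λ ())
letter-≟ (ly s) (ly t) with s FinP.≟ t
... | yes refl = yes refl
... | no s≢t = no (λ { refl → s≢t refl })

word-≟ : {m : ℕ} → DecidableEquality (Word m)
word-≟ = ListP.≡-dec letter-≟

Poly : ℕ → Set
Poly m = List (ℚ × Word m)

coeff : {m : ℕ} → Poly m → Word m → ℚ
coeff [] u = 0ℚ
coeff ((c , w) ∷ p) u with word-≟ w u
... | yes _ = c +ℚ coeff p u
... | no _ = coeff p u

infix 4 _≈_
_≈_ : {m : ℕ} → Poly m → Poly m → Set
p ≈ q = ∀ u → coeff p u ≡ coeff q u

0P : {m : ℕ} → Poly m
0P = []

wordP : {m : ℕ} → Word m → Poly m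
wordP w = [ (1ℚ , w) ]

1P : {m : ℕ} → Poly m
1P = wordP []

infixl 6 _+P_ _-P_
infixl 7 _*P_

_+P_ : {m : ℕ} → Poly m → Poly m → Poly m
p +P q = p ++ q

scale : {m : ℕ} → ℚ → Poly m → Poly m
scale c = map (λ { (d , w) → (c *ℚ d , w) })

-P_ : {m : ℕ} → Poly m → Poly m
-P p = scale (-ℚ 1ℚ) p

_-P_ : {m : ℕ} → Poly m → Poly m → Poly m
p -P q = p +P (-P q)

_*P_ : {m : ℕ} → Poly m → Poly m → Poly m
p *P q = concatMap (λ { (c , v) → map (λ { (d , w) → (c *ℚ d , v ++ w) }) q }) p

_·ℓ_ : {m : ℕ} → Poly m → Letter m → Poly m
p ·ℓ a = p *P wordP [ a ]

linExt : {m m' : ℕ} → (Word m → Poly m') → Poly m → Poly m'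
linExt f = concatMap (λ { (c , w) → scale c (f w) })

xP : {m : ℕ} → Poly m
xP = wordP [ lx ]

yP : {m : ℕ} → μ m → Poly m
yP s = wordP [ ly s ]

zP : {m : ℕ} → Poly m
zP = xP +P yP one-μ

data Letter₁ : Set where
  x₁ y₁ : Letter₁

Word₁ : Set
Word₁ = List Letter₁

Poly₁ : Set
Poly₁ = List (ℚ × Word₁)

infixl 7 _*P₁_
_*P₁_ : Poly₁ → Poly₁ → Poly₁
p *P₁ q = concatMap (λ { (c , v) → map (λ { (d , w) → (c *ℚ d , v ++ w) }) q }) p

z₁ : Poly₁
z₁ = (1ℚ , [ x₁ ]) ∷ (1ℚ , [ y₁ ]) ∷ []

embL : {m : ℕ} → Letter₁ → Letter m
embL x₁ = lx
embL y₁ = ly one-μ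

embW : {m : ℕ} → Word₁ → Word m
embW = map embL

φL : {m : ℕ} → Letter m → Poly m
φL lx = zP
φL (ly s) = scale (δ s) (yP s) -P yP one-μ

φW : {m : ℕ} → Word m → Poly m
φW [] = 1P
φW (a ∷ w) = φL a *P φW w

φ : {m : ℕ} → Poly m → Poly m
φ = linExt φW

-- I(z_{k1,s1} ⋯ z_{kl,sl} x^a) = z_{k1,s1} z_{k2,s1s2} ⋯ z_{kl,s1⋯sl} x^a
IW-acc : {m : ℕ} → μ m → Word m → Word m
IW-acc acc [] = []
IW-acc acc (lx ∷ w) = lx ∷ IW-acc acc w
IW-acc acc (ly s ∷ w) = ly (acc ·μ s) ∷ IW-acc (acc ·μ s) w

IW : {m : ℕ} → Word m → Word m
IW = IW-acc one-μ

-- M_s(z_{k1,s1} z_{k2,s2} ⋯ x^a) = z_{k1,s s1} z_{k2,s2} ⋯ x^a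
MW : {m : ℕ} → μ m → Word m → Word m
MW s [] = []
MW s (lx ∷ w) = lx ∷ MW s w
MW s (ly t ∷ w) = ly (s ·μ t) ∷ w

ψ : {m : ℕ} → μ m → Poly m → Poly m
ψ s = φ ∘' linExt (λ w → wordP (IW (MW s w)))
  where
  _∘'_ : {A B C : Set} → (B → C) → (A → B) → A → C
  (f ∘' g) a = f (g a)

-- Words are processed from the right, so the
-- helper takes the *reversed* words (head = last letter).  The fuel
-- argument only guarantees termination: each recursive call lowers the
-- total length |v| + |w|, and diamW supplies fuel |v| + |w|.

diamR : {m : ℕ} → ℕ → μ m → List Letter₁ → List (Letter m) → Poly m
diamR _ s [] rw = wordP (reverse rw)
diamR _ s (a ∷ rv) [] = ψ s (φ (wordP (embW (reverse (a ∷ rv)))))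
diamR zero s (_ ∷ _) (_ ∷ _) = 0P
diamR (suc n) s (x₁ ∷ rv) (lx ∷ rw) =
  (diamR n s rv (lx ∷ rw) ·ℓ lx) -P (diamR n s (y₁ ∷ rv) rw ·ℓ lx)
diamR (suc n) s (y₁ ∷ rv) (lx ∷ rw) =
  (diamR n s rv (lx ∷ rw) ·ℓ ly one-μ) +P (diamR n s (y₁ ∷ rv) rw ·ℓ lx)
diamR (suc n) s (x₁ ∷ rv) (ly zero ∷ rw) =
  (diamR n s rv (ly zero ∷ rw) ·ℓ lx) +P (diamR n s (x₁ ∷ rv) rw ·ℓ ly zero)
diamR (suc n) s (y₁ ∷ rv) (ly zero ∷ rw) =
  (diamR n s rv (ly zero ∷ rw) ·ℓ ly zero) -P (diamR n s (x₁ ∷ rv) rw ·ℓ ly zero)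
-- vx ⋄ wy_t, vy ⋄ wy_t  (t ≠ 1);  w z_t = w x + w y_t
diamR (suc n) s (x₁ ∷ rv) (ly (suc t) ∷ rw) =
  ((diamR n s rv (ly (suc t) ∷ rw) ·ℓ lx)
   +P ((diamR n s rv (lx ∷ rw) +P diamR n s rv (ly (suc t) ∷ rw)) ·ℓ ly (suc t)))
   -P (diamR n s (y₁ ∷ rv) rw ·ℓ ly (suc t))
diamR (suc n) s (y₁ ∷ rv) (ly (suc t) ∷ rw) =
  ((diamR n s rv (ly (suc t) ∷ rw) ·ℓ ly zero)
   -P ((diamR n s rv (lx ∷ rw) +P diamR n s rv (ly (suc t) ∷ rw)) ·ℓ ly (suc t)))
   +P (diamR n s (y₁ ∷ rv) rw ·ℓ ly (suc t))

diamW : {m : ℕ} → μ m → Word₁ → Word m → Poly m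
diamW s v w = diamR (length v +ℕ length w) s (reverse v) (reverse w)

diamond : {m : ℕ} → μ m → Poly₁ → Poly m → Poly m
diamond s v w =
  concatMap (λ { (c , v') → concatMap (λ { (d , w') → scale (c *ℚ d) (diamW s v' w') }) w }) v

syntax diamond s v w = v ⋄[ s ] w

-- Both identities are linear, so it suffices to test them against every linear functional
-- h on words, where right multiplication by a letter a becomes h ▹ a : u ↦ h (u a).  On words
-- they reduce to the two rules vx ⋄ w + vy ⋄ w = (v ⋄ w) z and v ⋄ wx + v ⋄ wy = (v ⋄ w) z.
-- In the first, every defining rule for the last letter of w cancels in the sum; for w = 1 it
-- is the fact that φ(z) = x and that ψ_s(u x) = ψ_s(u) z, because I and M_s fix a trailing x
-- and φ(x) = z.  The second follows by induction on v from the first.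
module Submission where

open import Defs
open import Data.Nat using (ℕ; suc) renaming (_+_ to _+ℕ_)
open import Data.Nat.Properties using (+-suc)
open import Data.Fin using (Fin; zero; suc)
open import Data.List using (List; []; _∷_; _++_; [_]; map; concatMap; reverse; length)
open import Data.List.Properties using (++-assoc; map-++; unfold-reverse; reverse-++; length-reverse)
open import Data.Product using (_×_; _,_)
open import Data.Rational using (ℚ; 0ℚ; 1ℚ; _+_; _*_; -_; _-_)
import Data.Rational.Properties as ℚ
open import Data.Rational.Solver using (module +-*-Solver)
open import Relation.Binary.PropositionalEquality
  using (_≡_; refl; sym; trans; cong; cong₂; module ≡-Reasoning)
open import Relation.Nullary using (yes; no)

open ≡-Reasoning

private variable
  A B L : Set

pattern ly₁ = ly zero

sub-add-cancel : ∀ a b c → (a - b) + (c + b) ≡ a + c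
sub-add-cancel = solve 3 (λ a b c → (a :- b) :+ (c :+ b) := a :+ c) refl
  where open +-*-Solver

add-sub-cancel : ∀ a b c → (a + b) + (c - b) ≡ a + c
add-sub-cancel = solve 3 (λ a b c → (a :+ b) :+ (c :- b) := a :+ c) refl
  where open +-*-Solver

add-sub-sub-add-cancel : ∀ a z b c → (a + z - b) + (c - z + b) ≡ a + c
add-sub-sub-add-cancel = solve 4 (λ a z b c → (a :+ z :- b) :+ (c :- z :+ b) := a :+ c) refl
  where open +-*-Solver

exchange-sub-add : ∀ a b c d e → a + b ≡ e + d → (a - d) + (b + c) ≡ e + c
exchange-sub-add a b c d e a+b≡e+d = begin
  (a - d) + (b + c)  ≡⟨ solve 4 (λ a b d c → (a :- d) :+ (b :+ c) := (a :+ b) :- d :+ c) refl a b d c ⟩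
  (a + b) - d + c    ≡⟨ cong (λ t → t - d + c) a+b≡e+d ⟩
  (e + d) - d + c    ≡⟨ solve 3 (λ e d c → (e :+ d) :- d :+ c := e :+ c) refl e d c ⟩
  e + c              ∎
  where open +-*-Solver

exchange-add-sub : ∀ a b c d e → a + b ≡ c + e → (a + d) + (b - c) ≡ d + e
exchange-add-sub a b c d e a+b≡c+e = begin
  (a + d) + (b - c)  ≡⟨ solve 4 (λ a b c d → (a :+ d) :+ (b :- c) := (a :+ b) :- c :+ d) refl a b c d ⟩
  (a + b) - c + d    ≡⟨ cong (λ t → t - c + d) a+b≡c+e ⟩
  (c + e) - c + d    ≡⟨ solve 3 (λ c e d → (c :+ e) :- c :+ d := d :+ e) refl c e d ⟩
  d + e              ∎
  where open +-*-Solver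

-- Pairing formal linear combinations with functionals

infixl 6 _⊕_
infixl 7 _▹_

⟨_∣_⟩ : (A → ℚ) → List (ℚ × A) → ℚ
⟨ h ∣ [] ⟩ = 0ℚ
⟨ h ∣ (c , a) ∷ p ⟩ = c * h a + ⟨ h ∣ p ⟩

_⊕_ : (A → ℚ) → (A → ℚ) → A → ℚ
(h ⊕ k) a = h a + k a

⟨⟩-++ : (h : A → ℚ) (p q : List (ℚ × A)) → ⟨ h ∣ p ++ q ⟩ ≡ ⟨ h ∣ p ⟩ + ⟨ h ∣ q ⟩
⟨⟩-++ h [] q = sym (ℚ.+-identityˡ _)
⟨⟩-++ h ((c , a) ∷ p) q =
  trans (cong (c * h a +_) (⟨⟩-++ h p q)) (sym (ℚ.+-assoc (c * h a) ⟨ h ∣ p ⟩ ⟨ h ∣ q ⟩))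

⟨⟩-congˡ : {h k : A → ℚ} → (∀ a → h a ≡ k a) → (p : List (ℚ × A)) → ⟨ h ∣ p ⟩ ≡ ⟨ k ∣ p ⟩
⟨⟩-congˡ h≗k [] = refl
⟨⟩-congˡ h≗k ((c , a) ∷ p) = cong₂ (λ x y → c * x + y) (h≗k a) (⟨⟩-congˡ h≗k p)

⟨⟩-⊕ : (h k : A → ℚ) (p : List (ℚ × A)) → ⟨ h ⊕ k ∣ p ⟩ ≡ ⟨ h ∣ p ⟩ + ⟨ k ∣ p ⟩
⟨⟩-⊕ h k [] = sym (ℚ.+-identityˡ _)
⟨⟩-⊕ h k ((c , a) ∷ p) = trans (cong (c * (h a + k a) +_) (⟨⟩-⊕ h k p))
  (solve 5 (λ c x y u v → c :* (x :+ y) :+ (u :+ v) := (c :* x :+ u) :+ (c :* y :+ v))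
         refl c (h a) (k a) ⟨ h ∣ p ⟩ ⟨ k ∣ p ⟩)
  where open +-*-Solver

⟨⟩-*ˡ : (c : ℚ) (h : A → ℚ) (p : List (ℚ × A)) → ⟨ (λ a → c * h a) ∣ p ⟩ ≡ c * ⟨ h ∣ p ⟩
⟨⟩-*ˡ c h [] = sym (ℚ.*-zeroʳ c)
⟨⟩-*ˡ c h ((d , a) ∷ p) = trans (cong (d * (c * h a) +_) (⟨⟩-*ˡ c h p))
  (solve 4 (λ c d x y → d :* (c :* x) :+ c :* y := c :* (d :* x :+ y)) refl c d (h a) ⟨ h ∣ p ⟩)
  where open +-*-Solver

⟨⟩-singleton : (h : A → ℚ) (a : A) → ⟨ h ∣ [ (1ℚ , a) ] ⟩ ≡ h a
⟨⟩-singleton h a = trans (ℚ.+-identityʳ _) (ℚ.*-identityˡ _)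

⟨⟩-pair : (h : A → ℚ) (a b : A) → ⟨ h ∣ (1ℚ , a) ∷ (1ℚ , b) ∷ [] ⟩ ≡ h a + h b
⟨⟩-pair h a b = cong₂ _+_ (ℚ.*-identityˡ (h a)) (⟨⟩-singleton h b)

⟨⟩-map : (h : B → ℚ) (c : ℚ) (g : A → B) (f : ℚ × A → ℚ × B) →
         (∀ d a → f (d , a) ≡ (c * d , g a)) →
         (p : List (ℚ × A)) → ⟨ h ∣ map f p ⟩ ≡ c * ⟨ (λ a → h (g a)) ∣ p ⟩
⟨⟩-map h c g f f≡ [] = sym (ℚ.*-zeroʳ c)
⟨⟩-map h c g f f≡ ((d , a) ∷ p) rewrite f≡ d a =
  trans (cong (c * d * h (g a) +_) (⟨⟩-map h c g f f≡ p))
    (solve 4 (λ c d x y → c :* d :* x :+ c :* y := c :* (d :* x :+ y)) refl c d (h (g a)) _)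
  where open +-*-Solver

⟨⟩-concatMap : (h : B → ℚ) (k : A → ℚ) (F : ℚ × A → List (ℚ × B)) →
               (∀ c a → ⟨ h ∣ F (c , a) ⟩ ≡ c * k a) →
               (p : List (ℚ × A)) → ⟨ h ∣ concatMap F p ⟩ ≡ ⟨ k ∣ p ⟩
⟨⟩-concatMap h k F F≡ [] = refl
⟨⟩-concatMap h k F F≡ ((c , a) ∷ p) =
  trans (⟨⟩-++ h (F (c , a)) (concatMap F p)) (cong₂ _+_ (F≡ c a) (⟨⟩-concatMap h k F F≡ p))

_▹_ : (List L → ℚ) → L → List L → ℚ
(h ▹ a) u = h (u ++ [ a ])

⟨⟩-*P₁ : (h : Word₁ → ℚ) (p q : Poly₁) → ⟨ h ∣ p *P₁ q ⟩ ≡ ⟨ (λ v → ⟨ (λ w → h (v ++ w)) ∣ q ⟩) ∣ p ⟩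
⟨⟩-*P₁ h p q = ⟨⟩-concatMap h _ _ (λ c v → ⟨⟩-map h c (v ++_) _ (λ _ _ → refl) q) p

⟨⟩-*z₁ : (h : Word₁ → ℚ) (p : Poly₁) → ⟨ h ∣ p *P₁ z₁ ⟩ ≡ ⟨ h ▹ x₁ ⊕ h ▹ y₁ ∣ p ⟩
⟨⟩-*z₁ h p = trans (⟨⟩-*P₁ h p z₁) (⟨⟩-congˡ (λ v → ⟨⟩-pair (λ w → h (v ++ w)) [ x₁ ] [ y₁ ]) p)

module _ {m : ℕ} where

  ⟨⟩-*P : (h : Word m → ℚ) (p q : Poly m) → ⟨ h ∣ p *P q ⟩ ≡ ⟨ (λ v → ⟨ (λ w → h (v ++ w)) ∣ q ⟩) ∣ p ⟩
  ⟨⟩-*P h p q = ⟨⟩-concatMap h _ _ (λ c v → ⟨⟩-map h c (v ++_) _ (λ _ _ → refl) q) p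

  ⟨⟩-*z : (h : Word m → ℚ) (p : Poly m) → ⟨ h ∣ p *P zP ⟩ ≡ ⟨ h ▹ lx ⊕ h ▹ ly₁ ∣ p ⟩
  ⟨⟩-*z h p = trans (⟨⟩-*P h p zP) (⟨⟩-congˡ (λ v → ⟨⟩-pair (λ w → h (v ++ w)) [ lx ] [ ly₁ ]) p)

  ⟨⟩-·ℓ : (h : Word m → ℚ) (p : Poly m) (a : Letter m) → ⟨ h ∣ p ·ℓ a ⟩ ≡ ⟨ h ▹ a ∣ p ⟩
  ⟨⟩-·ℓ h p a = trans (⟨⟩-*P h p (wordP [ a ])) (⟨⟩-congˡ (λ v → ⟨⟩-singleton (λ w → h (v ++ w)) [ a ]) p)

  ⟨⟩-scale : (h : Word m → ℚ) (c : ℚ) (p : Poly m) → ⟨ h ∣ scale c p ⟩ ≡ c * ⟨ h ∣ p ⟩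
  ⟨⟩-scale h c = ⟨⟩-map h c (λ w → w) _ (λ _ _ → refl)

  ⟨⟩--P : (h : Word m → ℚ) (p q : Poly m) → ⟨ h ∣ p -P q ⟩ ≡ ⟨ h ∣ p ⟩ - ⟨ h ∣ q ⟩
  ⟨⟩--P h p q = trans (⟨⟩-++ h p (-P q)) (cong (⟨ h ∣ p ⟩ +_) (begin
    ⟨ h ∣ scale (- 1ℚ) q ⟩  ≡⟨ ⟨⟩-scale h (- 1ℚ) q ⟩
    - 1ℚ * ⟨ h ∣ q ⟩        ≡⟨ ℚ.neg-distribˡ-* 1ℚ ⟨ h ∣ q ⟩ ⟨
    - (1ℚ * ⟨ h ∣ q ⟩)      ≡⟨ cong -_ (ℚ.*-identityˡ _) ⟩
    - ⟨ h ∣ q ⟩             ∎))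

  ⟨⟩-linExt : (h : Word m → ℚ) (f : Word m → Poly m) (p : Poly m) →
              ⟨ h ∣ linExt f p ⟩ ≡ ⟨ (λ w → ⟨ h ∣ f w ⟩) ∣ p ⟩
  ⟨⟩-linExt h f = ⟨⟩-concatMap h _ _ (λ c w → ⟨⟩-scale h c (f w))

  infix 4 _∼_
  _∼_ : Poly m → Poly m → Set
  p ∼ q = ∀ h → ⟨ h ∣ p ⟩ ≡ ⟨ h ∣ q ⟩

  coeff≡⟨⟩ : (p : Poly m) (u : Word m) → coeff p u ≡ ⟨ (λ w → coeff (wordP w) u) ∣ p ⟩
  coeff≡⟨⟩ [] u = refl
  coeff≡⟨⟩ ((c , w) ∷ p) u with word-≟ w u
  ... | yes _ = cong₂ _+_ (sym (trans (cong (c *_) (ℚ.+-identityʳ 1ℚ)) (ℚ.*-identityʳ c))) (coeff≡⟨⟩ p u)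
  ... | no _  = trans (coeff≡⟨⟩ p u) (sym (trans (cong (_+ _) (ℚ.*-zeroʳ c)) (ℚ.+-identityˡ _)))

  ∼⇒≈ : {p q : Poly m} → p ∼ q → p ≈ q
  ∼⇒≈ {p} {q} p∼q u = trans (coeff≡⟨⟩ p u) (trans (p∼q _) (sym (coeff≡⟨⟩ q u)))

module _ {m : ℕ} where

  ⟨⟩-φW-++ : (h : Word m → ℚ) (E F : Word m) →
             ⟨ h ∣ φW (E ++ F) ⟩ ≡ ⟨ (λ e → ⟨ (λ f → h (e ++ f)) ∣ φW F ⟩) ∣ φW E ⟩
  ⟨⟩-φW-++ h [] F = sym (⟨⟩-singleton (λ e → ⟨ (λ f → h (e ++ f)) ∣ φW F ⟩) [])
  ⟨⟩-φW-++ h (a ∷ E) F = begin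
    ⟨ h ∣ φL a *P φW (E ++ F) ⟩
      ≡⟨ ⟨⟩-*P h (φL a) (φW (E ++ F)) ⟩
    ⟨ (λ v → ⟨ (λ w → h (v ++ w)) ∣ φW (E ++ F) ⟩) ∣ φL a ⟩
      ≡⟨ ⟨⟩-congˡ (λ v → trans (⟨⟩-φW-++ (λ w → h (v ++ w)) E F)
           (⟨⟩-congˡ (λ e → ⟨⟩-congˡ (λ f → cong h (sym (++-assoc v e f))) (φW F)) (φW E))) (φL a) ⟩
    ⟨ (λ v → ⟨ (λ e → ⟨ (λ f → h ((v ++ e) ++ f)) ∣ φW F ⟩) ∣ φW E ⟩) ∣ φL a ⟩
      ≡⟨ ⟨⟩-*P _ (φL a) (φW E) ⟨
    ⟨ (λ e → ⟨ (λ f → h (e ++ f)) ∣ φW F ⟩) ∣ φL a *P φW E ⟩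
      ∎

  ⟨⟩-φx : (k : Word m → ℚ) → ⟨ k ∣ φW [ lx ] ⟩ ≡ k [ lx ] + k [ ly₁ ]
  ⟨⟩-φx k = solve 2 (λ a b → con 1ℚ :* con 1ℚ :* a :+ (con 1ℚ :* con 1ℚ :* b :+ con 0ℚ) := a :+ b)
                    refl (k [ lx ]) (k [ ly₁ ])
    where open +-*-Solver

  ⟨⟩-φy : (k : Word m → ℚ) → ⟨ k ∣ φW [ ly₁ ] ⟩ ≡ - k [ ly₁ ]
  ⟨⟩-φy k = solve 1 (λ b → con 0ℚ :* con 1ℚ :* con 1ℚ :* b :+ (con (- 1ℚ) :* con 1ℚ :* con 1ℚ :* b :+ con 0ℚ)
                             := :- b)
                    refl (k [ ly₁ ])
    where open +-*-Solver

  ⟨⟩-φW-x : (h : Word m → ℚ) (E : Word m) → ⟨ h ∣ φW (E ++ [ lx ]) ⟩ ≡ ⟨ h ▹ lx ⊕ h ▹ ly₁ ∣ φW E ⟩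
  ⟨⟩-φW-x h E = trans (⟨⟩-φW-++ h E [ lx ]) (⟨⟩-congˡ (λ e → ⟨⟩-φx (λ f → h (e ++ f))) (φW E))

  -- φ(z) = x
  ⟨⟩-φW-z : (h : Word m → ℚ) (E : Word m) →
            ⟨ h ∣ φW (E ++ [ lx ]) ⟩ + ⟨ h ∣ φW (E ++ [ ly₁ ]) ⟩ ≡ ⟨ h ▹ lx ∣ φW E ⟩
  ⟨⟩-φW-z h E = begin
    ⟨ h ∣ φW (E ++ [ lx ]) ⟩ + ⟨ h ∣ φW (E ++ [ ly₁ ]) ⟩
      ≡⟨ cong₂ _+_ (⟨⟩-φW-x h E)
           (trans (⟨⟩-φW-++ h E [ ly₁ ]) (⟨⟩-congˡ (λ e → ⟨⟩-φy (λ f → h (e ++ f))) (φW E))) ⟩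
    ⟨ h ▹ lx ⊕ h ▹ ly₁ ∣ φW E ⟩ + ⟨ (λ e → - h (e ++ [ ly₁ ])) ∣ φW E ⟩
      ≡⟨ ⟨⟩-⊕ (h ▹ lx ⊕ h ▹ ly₁) _ (φW E) ⟨
    ⟨ (h ▹ lx ⊕ h ▹ ly₁) ⊕ (λ e → - h (e ++ [ ly₁ ])) ∣ φW E ⟩
      ≡⟨ ⟨⟩-congˡ (λ e → solve 2 (λ a b → a :+ b :- b := a) refl (h (e ++ [ lx ])) (h (e ++ [ ly₁ ]))) (φW E) ⟩
    ⟨ h ▹ lx ∣ φW E ⟩
      ∎
    where open +-*-Solver

  MW-snoc-x : (s : μ m) (e : Word m) → MW s (e ++ [ lx ]) ≡ MW s e ++ [ lx ]
  MW-snoc-x s [] = refl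
  MW-snoc-x s (lx ∷ e) = cong (lx ∷_) (MW-snoc-x s e)
  MW-snoc-x s (ly t ∷ e) = refl

  IW-acc-snoc-x : (acc : μ m) (e : Word m) → IW-acc acc (e ++ [ lx ]) ≡ IW-acc acc e ++ [ lx ]
  IW-acc-snoc-x acc [] = refl
  IW-acc-snoc-x acc (lx ∷ e) = cong (lx ∷_) (IW-acc-snoc-x acc e)
  IW-acc-snoc-x acc (ly t ∷ e) = cong (ly (acc ·μ t) ∷_) (IW-acc-snoc-x (acc ·μ t) e)

  ψᵀ : μ m → (Word m → ℚ) → Word m → ℚ
  ψᵀ s h w = ⟨ h ∣ φW (IW (MW s w)) ⟩

  ⟨⟩-ψ : (s : μ m) (h : Word m → ℚ) (p : Poly m) → ⟨ h ∣ ψ s p ⟩ ≡ ⟨ ψᵀ s h ∣ p ⟩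
  ⟨⟩-ψ s h p = begin
    ⟨ h ∣ φ (linExt (λ w → wordP (IW (MW s w))) p) ⟩
      ≡⟨ ⟨⟩-linExt h φW (linExt (λ w → wordP (IW (MW s w))) p) ⟩
    ⟨ (λ w → ⟨ h ∣ φW w ⟩) ∣ linExt (λ w → wordP (IW (MW s w))) p ⟩
      ≡⟨ ⟨⟩-linExt (λ w → ⟨ h ∣ φW w ⟩) (λ w → wordP (IW (MW s w))) p ⟩
    ⟨ (λ w → ⟨ (λ w' → ⟨ h ∣ φW w' ⟩) ∣ wordP (IW (MW s w)) ⟩) ∣ p ⟩
      ≡⟨ ⟨⟩-congˡ (λ w → ⟨⟩-singleton (λ w' → ⟨ h ∣ φW w' ⟩) (IW (MW s w))) p ⟩
    ⟨ ψᵀ s h ∣ p ⟩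
      ∎

  ⟨⟩-ψφ : (s : μ m) (h : Word m → ℚ) (E : Word m) → ⟨ h ∣ ψ s (φ (wordP E)) ⟩ ≡ ⟨ ψᵀ s h ∣ φW E ⟩
  ⟨⟩-ψφ s h E = trans (⟨⟩-ψ s h (φ (wordP E)))
    (trans (⟨⟩-linExt (ψᵀ s h) φW (wordP E)) (⟨⟩-singleton (λ w → ⟨ ψᵀ s h ∣ φW w ⟩) E))

  -- ψ_s(e x) = ψ_s(e) z
  ψᵀ-snoc-x : (s : μ m) (h : Word m → ℚ) (e : Word m) →
              ψᵀ s h (e ++ [ lx ]) ≡ ψᵀ s (h ▹ lx) e + ψᵀ s (h ▹ ly₁) e
  ψᵀ-snoc-x s h e = begin
    ⟨ h ∣ φW (IW (MW s (e ++ [ lx ]))) ⟩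
      ≡⟨ cong (λ u → ⟨ h ∣ φW u ⟩) (trans (cong IW (MW-snoc-x s e)) (IW-acc-snoc-x one-μ (MW s e))) ⟩
    ⟨ h ∣ φW (IW (MW s e) ++ [ lx ]) ⟩
      ≡⟨ ⟨⟩-φW-x h (IW (MW s e)) ⟩
    ⟨ h ▹ lx ⊕ h ▹ ly₁ ∣ φW (IW (MW s e)) ⟩
      ≡⟨ ⟨⟩-⊕ (h ▹ lx) (h ▹ ly₁) (φW (IW (MW s e))) ⟩
    ψᵀ s (h ▹ lx) e + ψᵀ s (h ▹ ly₁) e
      ∎

module _ {m : ℕ} (s : μ m) where

  -- v ⋄_s w for the words v = reverse rv and w = reverse rw, with the fuel diamW supplies.
  D : List Letter₁ → Word m → Poly m
  D rv rw = diamR (length rv +ℕ length rw) s rv rw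

  diamW≡D : (v : Word₁) (w : Word m) → diamW s v w ≡ D (reverse v) (reverse w)
  diamW≡D v w = cong (λ n → diamR n s (reverse v) (reverse w))
    (sym (cong₂ _+ℕ_ (length-reverse v) (length-reverse w)))

  -- The recursive call on (a ∷ rv , rw) in the defining equations of diamR; only its fuel differs from D.
  D⁺ : Letter₁ → List Letter₁ → Word m → Poly m
  D⁺ a rv rw = diamR (length rv +ℕ suc (length rw)) s (a ∷ rv) rw

  ⟨⟩-·ℓ-D⁺ : (h : Word m → ℚ) (a : Letter₁) (rv : List Letter₁) (rw : Word m) (b : Letter m) →
             ⟨ h ∣ D⁺ a rv rw ·ℓ b ⟩ ≡ ⟨ h ▹ b ∣ D (a ∷ rv) rw ⟩
  ⟨⟩-·ℓ-D⁺ h a rv rw b = trans (⟨⟩-·ℓ h (D⁺ a rv rw) b)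
    (cong (λ n → ⟨ h ▹ b ∣ diamR n s (a ∷ rv) rw ⟩) (+-suc (length rv) (length rw)))

  1⋄wa : (h : Word m → ℚ) (rw : Word m) (a : Letter m) → ⟨ h ∣ D [] (a ∷ rw) ⟩ ≡ ⟨ h ▹ a ∣ D [] rw ⟩
  1⋄wa h rw a = begin
    ⟨ h ∣ wordP (reverse (a ∷ rw)) ⟩  ≡⟨ ⟨⟩-singleton h _ ⟩
    h (reverse (a ∷ rw))              ≡⟨ cong h (unfold-reverse a rw) ⟩
    h (reverse rw ++ [ a ])           ≡⟨ ⟨⟩-singleton (h ▹ a) _ ⟨
    ⟨ h ▹ a ∣ wordP (reverse rw) ⟩    ∎

  v⋄1 : (h : Word m → ℚ) (rv : List Letter₁) → ⟨ h ∣ D rv [] ⟩ ≡ ⟨ ψᵀ s h ∣ φW (embW (reverse rv)) ⟩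
  v⋄1 h [] = trans (⟨⟩-singleton h []) (sym (trans (⟨⟩-singleton (ψᵀ s h) []) (⟨⟩-singleton h [])))
  v⋄1 h (a ∷ rv) = ⟨⟩-ψφ s h (embW (reverse (a ∷ rv)))

  module _ (rv : List Letter₁) (rw : Word m) (h : Word m → ℚ) where

    private
      v⋄w : Letter m → Poly m
      v⋄w a = D rv (a ∷ rw)

    vx⋄wx : ⟨ h ∣ D (x₁ ∷ rv) (lx ∷ rw) ⟩ ≡ ⟨ h ▹ lx ∣ D rv (lx ∷ rw) ⟩ - ⟨ h ▹ lx ∣ D (y₁ ∷ rv) rw ⟩
    vx⋄wx = trans (⟨⟩--P h (v⋄w lx ·ℓ lx) (D⁺ y₁ rv rw ·ℓ lx))
      (cong₂ _-_ (⟨⟩-·ℓ h (v⋄w lx) lx) (⟨⟩-·ℓ-D⁺ h y₁ rv rw lx))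

    vy⋄wx : ⟨ h ∣ D (y₁ ∷ rv) (lx ∷ rw) ⟩ ≡ ⟨ h ▹ ly₁ ∣ D rv (lx ∷ rw) ⟩ + ⟨ h ▹ lx ∣ D (y₁ ∷ rv) rw ⟩
    vy⋄wx = trans (⟨⟩-++ h (v⋄w lx ·ℓ ly₁) (D⁺ y₁ rv rw ·ℓ lx))
      (cong₂ _+_ (⟨⟩-·ℓ h (v⋄w lx) ly₁) (⟨⟩-·ℓ-D⁺ h y₁ rv rw lx))

    vx⋄wy : ⟨ h ∣ D (x₁ ∷ rv) (ly₁ ∷ rw) ⟩ ≡ ⟨ h ▹ lx ∣ D rv (ly₁ ∷ rw) ⟩ + ⟨ h ▹ ly₁ ∣ D (x₁ ∷ rv) rw ⟩
    vx⋄wy = trans (⟨⟩-++ h (v⋄w ly₁ ·ℓ lx) (D⁺ x₁ rv rw ·ℓ ly₁))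
      (cong₂ _+_ (⟨⟩-·ℓ h (v⋄w ly₁) lx) (⟨⟩-·ℓ-D⁺ h x₁ rv rw ly₁))

    vy⋄wy : ⟨ h ∣ D (y₁ ∷ rv) (ly₁ ∷ rw) ⟩ ≡ ⟨ h ▹ ly₁ ∣ D rv (ly₁ ∷ rw) ⟩ - ⟨ h ▹ ly₁ ∣ D (x₁ ∷ rv) rw ⟩
    vy⋄wy = trans (⟨⟩--P h (v⋄w ly₁ ·ℓ ly₁) (D⁺ x₁ rv rw ·ℓ ly₁))
      (cong₂ _-_ (⟨⟩-·ℓ h (v⋄w ly₁) ly₁) (⟨⟩-·ℓ-D⁺ h x₁ rv rw ly₁))

    module _ (t : Fin m) where

      private
        yₜ : Letter m
        yₜ = ly (suc t)

        v⋄wzₜ : Poly m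
        v⋄wzₜ = v⋄w lx +P v⋄w yₜ

      vx⋄wyₜ : ⟨ h ∣ D (x₁ ∷ rv) (yₜ ∷ rw) ⟩ ≡
               ⟨ h ▹ lx ∣ D rv (yₜ ∷ rw) ⟩ + ⟨ h ▹ yₜ ∣ v⋄wzₜ ⟩ - ⟨ h ▹ yₜ ∣ D (y₁ ∷ rv) rw ⟩
      vx⋄wyₜ = trans (⟨⟩--P h (v⋄w yₜ ·ℓ lx +P v⋄wzₜ ·ℓ yₜ) (D⁺ y₁ rv rw ·ℓ yₜ))
        (cong₂ _-_ (trans (⟨⟩-++ h (v⋄w yₜ ·ℓ lx) (v⋄wzₜ ·ℓ yₜ))
                          (cong₂ _+_ (⟨⟩-·ℓ h (v⋄w yₜ) lx) (⟨⟩-·ℓ h v⋄wzₜ yₜ)))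
                   (⟨⟩-·ℓ-D⁺ h y₁ rv rw yₜ))

      vy⋄wyₜ : ⟨ h ∣ D (y₁ ∷ rv) (yₜ ∷ rw) ⟩ ≡
               ⟨ h ▹ ly₁ ∣ D rv (yₜ ∷ rw) ⟩ - ⟨ h ▹ yₜ ∣ v⋄wzₜ ⟩ + ⟨ h ▹ yₜ ∣ D (y₁ ∷ rv) rw ⟩
      vy⋄wyₜ = trans (⟨⟩-++ h (v⋄w yₜ ·ℓ ly₁ -P v⋄wzₜ ·ℓ yₜ) (D⁺ y₁ rv rw ·ℓ yₜ))
        (cong₂ _+_ (trans (⟨⟩--P h (v⋄w yₜ ·ℓ ly₁) (v⋄wzₜ ·ℓ yₜ))
                          (cong₂ _-_ (⟨⟩-·ℓ h (v⋄w yₜ) ly₁) (⟨⟩-·ℓ h v⋄wzₜ yₜ)))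
                   (⟨⟩-·ℓ-D⁺ h y₁ rv rw yₜ))

  vx⋄w+vy⋄w : (rv : List Letter₁) (rw : Word m) (h : Word m → ℚ) →
              ⟨ h ∣ D (x₁ ∷ rv) rw ⟩ + ⟨ h ∣ D (y₁ ∷ rv) rw ⟩ ≡ ⟨ h ▹ lx ∣ D rv rw ⟩ + ⟨ h ▹ ly₁ ∣ D rv rw ⟩
  vx⋄w+vy⋄w rv [] h = begin
    ⟨ h ∣ D (x₁ ∷ rv) [] ⟩ + ⟨ h ∣ D (y₁ ∷ rv) [] ⟩
      ≡⟨ cong₂ _+_ (trans (v⋄1 h (x₁ ∷ rv)) (cong (λ u → ⟨ ψᵀ s h ∣ φW u ⟩) (embW-snoc x₁)))
                   (trans (v⋄1 h (y₁ ∷ rv)) (cong (λ u → ⟨ ψᵀ s h ∣ φW u ⟩) (embW-snoc y₁))) ⟩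
    ⟨ ψᵀ s h ∣ φW (E ++ [ lx ]) ⟩ + ⟨ ψᵀ s h ∣ φW (E ++ [ ly₁ ]) ⟩
      ≡⟨ ⟨⟩-φW-z (ψᵀ s h) E ⟩
    ⟨ ψᵀ s h ▹ lx ∣ φW E ⟩
      ≡⟨ trans (⟨⟩-congˡ (ψᵀ-snoc-x s h) (φW E)) (⟨⟩-⊕ (ψᵀ s (h ▹ lx)) (ψᵀ s (h ▹ ly₁)) (φW E)) ⟩
    ⟨ ψᵀ s (h ▹ lx) ∣ φW E ⟩ + ⟨ ψᵀ s (h ▹ ly₁) ∣ φW E ⟩
      ≡⟨ cong₂ _+_ (v⋄1 (h ▹ lx) rv) (v⋄1 (h ▹ ly₁) rv) ⟨
    ⟨ h ▹ lx ∣ D rv [] ⟩ + ⟨ h ▹ ly₁ ∣ D rv [] ⟩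
      ∎
    where
    E : Word m
    E = embW (reverse rv)

    embW-snoc : (a : Letter₁) → embW (reverse (a ∷ rv)) ≡ E ++ [ embL a ]
    embW-snoc a = trans (cong embW (unfold-reverse a rv)) (map-++ embL (reverse rv) [ a ])
  vx⋄w+vy⋄w rv (lx ∷ rw) h = trans (cong₂ _+_ (vx⋄wx rv rw h) (vy⋄wx rv rw h))
    (sub-add-cancel ⟨ h ▹ lx ∣ D rv (lx ∷ rw) ⟩ ⟨ h ▹ lx ∣ D (y₁ ∷ rv) rw ⟩ ⟨ h ▹ ly₁ ∣ D rv (lx ∷ rw) ⟩)
  vx⋄w+vy⋄w rv (ly₁ ∷ rw) h = trans (cong₂ _+_ (vx⋄wy rv rw h) (vy⋄wy rv rw h))
    (add-sub-cancel ⟨ h ▹ lx ∣ D rv (ly₁ ∷ rw) ⟩ ⟨ h ▹ ly₁ ∣ D (x₁ ∷ rv) rw ⟩ ⟨ h ▹ ly₁ ∣ D rv (ly₁ ∷ rw) ⟩)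
  vx⋄w+vy⋄w rv (ly (suc t) ∷ rw) h = trans (cong₂ _+_ (vx⋄wyₜ rv rw h t) (vy⋄wyₜ rv rw h t))
    (add-sub-sub-add-cancel ⟨ h ▹ lx ∣ D rv (yₜ ∷ rw) ⟩ ⟨ h ▹ yₜ ∣ D rv (lx ∷ rw) +P D rv (yₜ ∷ rw) ⟩
                            ⟨ h ▹ yₜ ∣ D (y₁ ∷ rv) rw ⟩ ⟨ h ▹ ly₁ ∣ D rv (yₜ ∷ rw) ⟩)
    where
    yₜ : Letter m
    yₜ = ly (suc t)

  v⋄wx+v⋄wy : (rv : List Letter₁) (rw : Word m) (h : Word m → ℚ) →
              ⟨ h ∣ D rv (lx ∷ rw) ⟩ + ⟨ h ∣ D rv (ly₁ ∷ rw) ⟩ ≡ ⟨ h ▹ lx ∣ D rv rw ⟩ + ⟨ h ▹ ly₁ ∣ D rv rw ⟩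
  v⋄wx+v⋄wy [] rw h = cong₂ _+_ (1⋄wa h rw lx) (1⋄wa h rw ly₁)
  v⋄wx+v⋄wy (x₁ ∷ rv) rw h =
    trans (cong₂ _+_ (vx⋄wx rv rw h) (vx⋄wy rv rw h))
          (exchange-sub-add ⟨ h ▹ lx ∣ D rv (lx ∷ rw) ⟩ ⟨ h ▹ lx ∣ D rv (ly₁ ∷ rw) ⟩
                            ⟨ h ▹ ly₁ ∣ D (x₁ ∷ rv) rw ⟩ ⟨ h ▹ lx ∣ D (y₁ ∷ rv) rw ⟩
                            ⟨ h ▹ lx ∣ D (x₁ ∷ rv) rw ⟩
            (trans (v⋄wx+v⋄wy rv rw (h ▹ lx)) (sym (vx⋄w+vy⋄w rv rw (h ▹ lx)))))
  v⋄wx+v⋄wy (y₁ ∷ rv) rw h =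
    trans (cong₂ _+_ (vy⋄wx rv rw h) (vy⋄wy rv rw h))
          (exchange-add-sub ⟨ h ▹ ly₁ ∣ D rv (lx ∷ rw) ⟩ ⟨ h ▹ ly₁ ∣ D rv (ly₁ ∷ rw) ⟩
                            ⟨ h ▹ ly₁ ∣ D (x₁ ∷ rv) rw ⟩ ⟨ h ▹ lx ∣ D (y₁ ∷ rv) rw ⟩
                            ⟨ h ▹ ly₁ ∣ D (y₁ ∷ rv) rw ⟩
            (trans (v⋄wx+v⋄wy rv rw (h ▹ ly₁)) (sym (vx⋄w+vy⋄w rv rw (h ▹ ly₁)))))

  ⋄ᵀ : (Word m → ℚ) → Word₁ → Word m → ℚ
  ⋄ᵀ h v w = ⟨ h ∣ D (reverse v) (reverse w) ⟩

  ⟨⟩-⋄ : (h : Word m → ℚ) (v : Poly₁) (w : Poly m) →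
         ⟨ h ∣ v ⋄[ s ] w ⟩ ≡ ⟨ (λ v' → ⟨ ⋄ᵀ h v' ∣ w ⟩) ∣ v ⟩
  ⟨⟩-⋄ h v w = ⟨⟩-concatMap h _ _ row v
    where
    row : ∀ c v' → ⟨ h ∣ concatMap (λ { (d , w') → scale (c * d) (diamW s v' w') }) w ⟩ ≡ c * ⟨ ⋄ᵀ h v' ∣ w ⟩
    row c v' = trans (⟨⟩-concatMap h (λ w' → c * ⋄ᵀ h v' w') _ entry w) (⟨⟩-*ˡ c (⋄ᵀ h v') w)
      where
      entry : ∀ d w' → ⟨ h ∣ scale (c * d) (diamW s v' w') ⟩ ≡ d * (c * ⋄ᵀ h v' w')
      entry d w' = begin
        ⟨ h ∣ scale (c * d) (diamW s v' w') ⟩  ≡⟨ ⟨⟩-scale h (c * d) (diamW s v' w') ⟩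
        c * d * ⟨ h ∣ diamW s v' w' ⟩          ≡⟨ cong (λ p → c * d * ⟨ h ∣ p ⟩) (diamW≡D v' w') ⟩
        c * d * ⋄ᵀ h v' w'                     ≡⟨ solve 3 (λ c d x → c :* d :* x := d :* (c :* x)) refl c d _ ⟩
        d * (c * ⋄ᵀ h v' w')                   ∎
        where open +-*-Solver

  ⋄ᵀ-z-left : (h : Word m → ℚ) (v : Word₁) (w : Word m) →
              ⋄ᵀ h (v ++ [ x₁ ]) w + ⋄ᵀ h (v ++ [ y₁ ]) w ≡ ⋄ᵀ (h ▹ lx ⊕ h ▹ ly₁) v w
  ⋄ᵀ-z-left h v w rewrite reverse-++ v [ x₁ ] | reverse-++ v [ y₁ ] =
    trans (vx⋄w+vy⋄w (reverse v) (reverse w) h) (sym (⟨⟩-⊕ (h ▹ lx) (h ▹ ly₁) (D (reverse v) (reverse w))))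

  ⋄ᵀ-z-right : (h : Word m → ℚ) (v : Word₁) (w : Word m) →
               ⋄ᵀ h v (w ++ [ lx ]) + ⋄ᵀ h v (w ++ [ ly₁ ]) ≡ ⋄ᵀ (h ▹ lx ⊕ h ▹ ly₁) v w
  ⋄ᵀ-z-right h v w rewrite reverse-++ w [ lx ] | reverse-++ w [ ly₁ ] =
    trans (v⋄wx+v⋄wy (reverse v) (reverse w) h) (sym (⟨⟩-⊕ (h ▹ lx) (h ▹ ly₁) (D (reverse v) (reverse w))))

  module _ (v : Poly₁) (w : Poly m) where

    ⋄-*z-left : (v *P₁ z₁) ⋄[ s ] w ∼ (v ⋄[ s ] w) *P zP
    ⋄-*z-left h = begin
      ⟨ h ∣ (v *P₁ z₁) ⋄[ s ] w ⟩
        ≡⟨ ⟨⟩-⋄ h (v *P₁ z₁) w ⟩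
      ⟨ (λ v' → ⟨ ⋄ᵀ h v' ∣ w ⟩) ∣ v *P₁ z₁ ⟩
        ≡⟨ ⟨⟩-*z₁ _ v ⟩
      ⟨ (λ v' → ⟨ ⋄ᵀ h (v' ++ [ x₁ ]) ∣ w ⟩ + ⟨ ⋄ᵀ h (v' ++ [ y₁ ]) ∣ w ⟩) ∣ v ⟩
        ≡⟨ ⟨⟩-congˡ (λ v' → trans (sym (⟨⟩-⊕ _ _ w)) (⟨⟩-congˡ (⋄ᵀ-z-left h v') w)) v ⟩
      ⟨ (λ v' → ⟨ ⋄ᵀ (h ▹ lx ⊕ h ▹ ly₁) v' ∣ w ⟩) ∣ v ⟩
        ≡⟨ ⟨⟩-⋄ _ v w ⟨
      ⟨ h ▹ lx ⊕ h ▹ ly₁ ∣ v ⋄[ s ] w ⟩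
        ≡⟨ ⟨⟩-*z h (v ⋄[ s ] w) ⟨
      ⟨ h ∣ (v ⋄[ s ] w) *P zP ⟩
        ∎

    ⋄-*z-right : v ⋄[ s ] (w *P zP) ∼ (v ⋄[ s ] w) *P zP
    ⋄-*z-right h = begin
      ⟨ h ∣ v ⋄[ s ] (w *P zP) ⟩
        ≡⟨ ⟨⟩-⋄ h v (w *P zP) ⟩
      ⟨ (λ v' → ⟨ ⋄ᵀ h v' ∣ w *P zP ⟩) ∣ v ⟩
        ≡⟨ ⟨⟩-congˡ (λ v' → trans (⟨⟩-*z (⋄ᵀ h v') w) (⟨⟩-congˡ (⋄ᵀ-z-right h v') w)) v ⟩
      ⟨ (λ v' → ⟨ ⋄ᵀ (h ▹ lx ⊕ h ▹ ly₁) v' ∣ w ⟩) ∣ v ⟩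
        ≡⟨ ⟨⟩-⋄ _ v w ⟨
      ⟨ h ▹ lx ⊕ h ▹ ly₁ ∣ v ⋄[ s ] w ⟩
        ≡⟨ ⟨⟩-*z h (v ⋄[ s ] w) ⟨
      ⟨ h ∣ (v ⋄[ s ] w) *P zP ⟩
        ∎

lemma5p2 : (m : ℕ) (s : μ m) (v : Poly₁) (w : Poly m) →
    ((v *P₁ z₁) ⋄[ s ] w ≈ v ⋄[ s ] (w *P zP)) × (v ⋄[ s ] (w *P zP) ≈ (v ⋄[ s ] w) *P zP)
lemma5p2 m s v w =
  ∼⇒≈ {p = (v *P₁ z₁) ⋄[ s ] w} {q = v ⋄[ s ] (w *P zP)}
      (λ h → trans (⋄-*z-left s v w h) (sym (⋄-*z-right s v w h))) ,
  ∼⇒≈ {p = v ⋄[ s ] (w *P zP)} {q = (v ⋄[ s ] w) *P zP} (⋄-*z-right s v w)
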